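{- Let $G$ be a finite cyclic group. Then $\mathcal{P}^{**}(G)$ does not contain the star graph $\Gamma_{1,3}$ as an induced subgraph if and only if $G$ is one of: (a) $\mathbb{Z}_{p^t}$; (b) $\mathbb{Z}_{pqr}$; (c) $\mathbb{Z}_{p^2q^2}$; (d) $\mathbb{Z}_{p^tq}$, where $p,q,r$ are pairwise distinct primes and $t\geq 1$.
   Context: For a finite group $G$, the power graph $\mathcal{P}(G)$ is the simple graph with vertex set $G$ in which two distinct vertices $u,v$ are adjacent iff $u^m=v$ or $v^n=u$ for some positive integers $m,n$. The proper power graph $\mathcal{P}^{**}(G)$ is obtained from $\mathcal{P}(G)$ by deleting all dominating vertices (vertices adjacent to all other vertices). $\Gamma_{1,3}$ is the star graph on $4$ vertices: one vertex adjacent to three others, which are pairwise non-adjacent. -}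

module Defs where

open import Data.Nat using (ℕ; _*_; _^_; _≤_; NonZero)
open import Data.Nat.DivMod using (_%_)
open import Data.Nat.Primality using (Prime)
open import Data.Fin using (Fin; toℕ)
open import Data.Product using (Σ; ∃; _×_; _,_)
open import Data.Sum using (_⊎_)
open import Relation.Nullary using (¬_)
open import Relation.Binary.PropositionalEquality using (_≡_; _≢_)

-- The finite cyclic group of order n is modelled as ℤ_n = Fin n under addition
-- modulo n.  The "power" u^m of u (m a positive integer) is, additively, m·u mod n.
pow : (n : ℕ) → .{{_ : NonZero n}} → ℕ → Fin n → ℕ
pow n m u = (m * toℕ u) % n

IsPowerOf : (n : ℕ) → .{{_ : NonZero n}} → Fin n → Fin n → Set
IsPowerOf n v u = Σ ℕ λ m → 1 ≤ m × pow n m u ≡ toℕ v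

Adj : (n : ℕ) → .{{_ : NonZero n}} → Fin n → Fin n → Set
Adj n u v = u ≢ v × (IsPowerOf n v u ⊎ IsPowerOf n u v)

Dominating : (n : ℕ) → .{{_ : NonZero n}} → Fin n → Set
Dominating n v = (w : Fin n) → w ≢ v → Adj n v w

HasInducedStar13 : (n : ℕ) → .{{_ : NonZero n}} → Set
HasInducedStar13 n =
  Σ (Fin n) λ c → Σ (Fin n) λ a → Σ (Fin n) λ b → Σ (Fin n) λ d →
    (¬ Dominating n c × ¬ Dominating n a × ¬ Dominating n b × ¬ Dominating n d) ×
    (c ≢ a × c ≢ b × c ≢ d × a ≢ b × a ≢ d × b ≢ d) ×
    (Adj n c a × Adj n c b × Adj n c d) ×
    (¬ Adj n a b × ¬ Adj n a d × ¬ Adj n b d)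

AllowedOrder : ℕ → Set
AllowedOrder n =
  (Σ ℕ λ p → Σ ℕ λ t → Prime p × 1 ≤ t × n ≡ p ^ t)
  ⊎ (Σ ℕ λ p → Σ ℕ λ q → Σ ℕ λ r → Prime p × Prime q × Prime r ×
       p ≢ q × p ≢ r × q ≢ r × n ≡ p * q * r)
  ⊎ (Σ ℕ λ p → Σ ℕ λ q → Prime p × Prime q × p ≢ q × n ≡ p ^ 2 * q ^ 2)
  ⊎ (Σ ℕ λ p → Σ ℕ λ q → Σ ℕ λ t → Prime p × Prime q × p ≢ q × 1 ≤ t ×
       n ≡ p ^ t * q)

-- In ℤ_n an element v is a positive multiple of u exactly when gcd(u, n) divides
-- gcd(v, n).  So two vertices of the power graph are adjacent iff their gcds with n
-- are comparable under divisibility, the dominating vertices are those with gcd 1 or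
-- n, and an induced Γ_{1,3} in P**(ℤ_n) amounts to a "claw" of divisors of n: a
-- centre c ∉ {1, n} comparable with three pairwise incomparable divisors.
--
-- Writing divisors of n = ∏ pᵢ^bᵢ as exponent vectors turns divisibility into the
-- componentwise order.  For p^t any two divisors are comparable, for p^t q two of
-- any three divisors share the exponent of q and are comparable, and for pqr and
-- p²q² a finite search shows there is no claw.  Every other n is divisible by
-- s·pqr (p, q, r distinct primes, s prime) or by p³q², and then the centre s with
-- leaves sp, sq, sr, or the centre p with leaves p³, p²q, pq², is a claw.

module Submission where

open import Defs
open import Data.Nat using (ℕ; _≤_; NonZero)
open import Relation.Nullary using (¬_)
open import Function.Bundles using (_⇔_)

open import Level using (0ℓ)
open import Data.Nat using (zero; suc; pred; _+_; _*_; _^_; _<_; _≤?_; _≟_; z≤n; s≤s;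
  NonTrivial; >-nonZero⁻¹; ≢-nonZero; ≢-nonZero⁻¹)
open import Data.Nat.Properties
open import Data.Nat.Divisibility
open import Data.Nat.DivMod using (_%_; [m+kn]%n≡m%n; %-distribˡ-*; m<n⇒m%n≡m)
open import Data.Nat.GCD using (gcd; gcd-GCD; gcd[m,n]∣m; gcd[m,n]∣n; gcd-greatest; module Bézout)
open import Data.Nat.Coprimality using (Coprime; coprime-divisor)
open import Data.Nat.Primality
  using (Prime; ¬prime[1]; prime⇒irreducible; prime⇒nonZero; prime⇒nonTrivial; euclidsLemma)
open import Data.Nat.Primality.Factorisation using (factorise)
open import Data.Nat.Induction using (<-wellFounded)
open import Data.Nat.Tactic.RingSolver using (solve-∀)
open import Data.Empty using (⊥-elim)
open import Data.Fin using (Fin; toℕ; fromℕ<)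
open import Data.Fin.Properties using (toℕ<n; toℕ-fromℕ<)
import Data.List as List
import Data.List.Relation.Unary.All as List
open import Data.Product using (Σ; ∃; ∃₂; _×_; _,_; proj₂)
open import Data.Sum as Sum using (_⊎_; inj₁; inj₂; [_,_]′; swap)
open import Data.Vec using (Vec; []; _∷_; replicate)
open import Data.Vec.Properties using (≡-dec)
open import Data.Vec.Relation.Binary.Pointwise.Inductive as Pointwise using (Pointwise; []; _∷_)
open import Data.Vec.Relation.Unary.All using (All; []; _∷_)
open import Data.Vec.Relation.Unary.AllPairs using (AllPairs; []; _∷_)
open import Function using (id; _∘_)
open import Function.Bundles using (mk⇔)
open import Induction.WellFounded using (Acc; acc)
open import Relation.Binary using (Rel; Reflexive; Decidable; DecidableEquality)
open import Relation.Binary.PropositionalEquality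
open import Relation.Nullary using (Dec; yes; no; contradiction)
open import Relation.Nullary.Decidable using (map′; _×-dec_; _⊎-dec_; _→-dec_; ¬?; from-yes)

Comparable : {A : Set} → Rel A 0ℓ → Rel A 0ℓ
Comparable _≼_ x y = x ≼ y ⊎ y ≼ x

incomparable⇒≢ : {A : Set} {_≼_ : Rel A 0ℓ} → Reflexive _≼_ →
  ∀ {x y} → ¬ Comparable _≼_ x y → x ≢ y
incomparable⇒≢ refl≼ x≁y refl = x≁y (inj₁ refl≼)

record Claw {A : Set} (_≼_ : Rel A 0ℓ) (c a b d : A) : Set where
  field
    c~a : Comparable _≼_ c a
    c~b : Comparable _≼_ c b
    c~d : Comparable _≼_ c d
    a≁b : ¬ Comparable _≼_ a b
    a≁d : ¬ Comparable _≼_ a d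
    b≁d : ¬ Comparable _≼_ b d

  c≢a : c ≢ a
  c≢a refl = a≁b c~b

  c≢b : c ≢ b
  c≢b refl = a≁b (swap c~a)

  c≢d : c ≢ d
  c≢d refl = a≁d (swap c~a)

claw? : {A : Set} {_≼_ : Rel A 0ℓ} → Decidable _≼_ → ∀ c a b d → Dec (Claw _≼_ c a b d)
claw? {_≼_ = _≼_} _≼?_ c a b d = map′
  (λ (c~a , c~b , c~d , a≁b , a≁d , b≁d) → record
    { c~a = c~a ; c~b = c~b ; c~d = c~d ; a≁b = a≁b ; a≁d = a≁d ; b≁d = b≁d })
  (λ claw → let open Claw claw in c~a , c~b , c~d , a≁b , a≁d , b≁d)
  (comparable? c a ×-dec comparable? c b ×-dec comparable? c d ×-dec
   ¬? (comparable? a b) ×-dec ¬? (comparable? a d) ×-dec ¬? (comparable? b d))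
  where
  comparable? : ∀ x y → Dec (Comparable _≼_ x y)
  comparable? x y = x ≼? y ⊎-dec y ≼? x

claw-reflect : {A B : Set} {_≤_ : Rel A 0ℓ} {_≼_ : Rel B 0ℓ} (f : A → B) →
  (∀ {x y} → x ≤ y → f x ≼ f y) → (∀ {x y} → f x ≼ f y → x ≤ y) →
  ∀ {c a b d} → Claw _≼_ (f c) (f a) (f b) (f d) → Claw _≤_ c a b d
claw-reflect {_≤_ = _≤_} {_≼_} f mono reflects claw = record
  { c~a = reflect c~a ; c~b = reflect c~b ; c~d = reflect c~d
  ; a≁b = a≁b ∘ preserve ; a≁d = a≁d ∘ preserve ; b≁d = b≁d ∘ preserve }
  where
  open Claw claw
  reflect : ∀ {x y} → Comparable _≼_ (f x) (f y) → Comparable _≤_ x y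
  reflect = Sum.map reflects reflects
  preserve : ∀ {x y} → Comparable _≤_ x y → Comparable _≼_ (f x) (f y)
  preserve = Sum.map mono mono

-- The gcds with n of the vertices of an induced Γ_{1,3} in P**(ℤ_n).
record DivisorClaw (n : ℕ) : Set where
  field
    c a b d : ℕ
    c∣n : c ∣ n
    a∣n : a ∣ n
    b∣n : b ∣ n
    d∣n : d ∣ n
    c≢1 : c ≢ 1
    c≢n : c ≢ n
    claw : Claw _∣_ c a b d

prime∤1 : ∀ {p} → Prime p → ¬ p ∣ 1
prime∤1 pp p∣1 = ¬prime[1] (subst Prime (∣1⇒≡1 p∣1) pp)

prime∤prime : ∀ {p q} → Prime p → Prime q → p ≢ q → ¬ p ∣ q
prime∤prime pp pq p≢q p∣q with prime⇒irreducible pq p∣q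
... | inj₁ refl = ¬prime[1] pp
... | inj₂ p≡q  = p≢q p≡q

primes-incomparable : ∀ {p q} → Prime p → Prime q → p ≢ q → ¬ Comparable _∣_ p q
primes-incomparable pp pq p≢q = [ prime∤prime pp pq p≢q , prime∤prime pq pp (p≢q ∘ sym) ]′

prime∤* : ∀ {p m n} → Prime p → ¬ p ∣ m → ¬ p ∣ n → ¬ p ∣ m * n
prime∤* {m = m} {n} pp p∤m p∤n p∣mn = [ p∤m , p∤n ]′ (euclidsLemma m n pp p∣mn)

prime∤^ : ∀ {p m} → Prime p → ¬ p ∣ m → ∀ e → ¬ p ∣ m ^ e
prime∤^ pp p∤m zero    = prime∤1 pp
prime∤^ pp p∤m (suc e) = prime∤* pp p∤m (prime∤^ pp p∤m e)

prime∤⇒coprime : ∀ {p m} → Prime p → ¬ p ∣ m → Coprime m p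
prime∤⇒coprime pp p∤m (d∣m , d∣p) with prime⇒irreducible pp d∣p
... | inj₁ d≡1 = d≡1
... | inj₂ refl = contradiction d∣m p∤m

^-monoʳ-∣ : ∀ p {i j} → i ≤ j → p ^ i ∣ p ^ j
^-monoʳ-∣ p z≤n       = 1∣ _
^-monoʳ-∣ p (s≤s i≤j) = *-monoʳ-∣ p (^-monoʳ-∣ p i≤j)

*-incomparable : ∀ z .{{_ : NonZero z}} {x y} →
  ¬ Comparable _∣_ x y → ¬ Comparable _∣_ (z * x) (z * y)
*-incomparable z x≁y = x≁y ∘ Sum.map (*-cancelˡ-∣ z) (*-cancelˡ-∣ z)

∣p^a*m⇒ : ∀ {p m d} → Prime p → ∀ a → d ∣ p ^ a * m →
  ∃₂ λ i d′ → i ≤ a × d′ ∣ m × d ≡ p ^ i * d′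
∣p^a*m⇒ {m = m} {d} pp zero d∣m =
  0 , d , z≤n , subst (d ∣_) (*-identityˡ m) d∣m , sym (*-identityˡ d)
∣p^a*m⇒ {p} {m} {d} pp (suc a) d∣ with p ∣? d
... | no p∤d =
  let i , d′ , i≤a , d′∣m , d≡ = ∣p^a*m⇒ pp a d∣p^a*m
  in i , d′ , m≤n⇒m≤1+n i≤a , d′∣m , d≡
  where
  d∣p^a*m : d ∣ p ^ a * m
  d∣p^a*m = coprime-divisor (prime∤⇒coprime pp p∤d) (subst (d ∣_) (*-assoc p (p ^ a) m) d∣)
... | yes (divides e refl) =
  let i , d′ , i≤a , d′∣m , e≡ = ∣p^a*m⇒ pp a e∣p^a*m
  in suc i , d′ , s≤s i≤a , d′∣m ,
     trans (cong (_* p) e≡) (trans (*-comm _ p) (sym (*-assoc p (p ^ i) d′)))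
  where
  e∣p^a*m : e ∣ p ^ a * m
  e∣p^a*m = *-cancelˡ-∣ p {{prime⇒nonZero pp}}
    (subst₂ _∣_ (*-comm e p) (*-assoc p (p ^ a) m) d∣)

p^i∣p^k*m⇒i≤k : ∀ {p m} → Prime p → ¬ p ∣ m → ∀ i k → p ^ i ∣ p ^ k * m → i ≤ k
p^i∣p^k*m⇒i≤k pp p∤m zero    k       _ = z≤n
p^i∣p^k*m⇒i≤k {p} {m} pp p∤m (suc i) zero    h =
  contradiction (∣-trans (m∣m*n (p ^ i)) (subst (_ ∣_) (*-identityˡ m) h)) p∤m
p^i∣p^k*m⇒i≤k {p} {m} pp p∤m (suc i) (suc k) h = s≤s (p^i∣p^k*m⇒i≤k pp p∤m i k
  (*-cancelˡ-∣ p {{prime⇒nonZero pp}} (subst (p * p ^ i ∣_) (*-assoc p (p ^ k) m) h)))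

coprime-∣p^k*m⇒∣m : ∀ {x p m} → Coprime x p → ∀ k → x ∣ p ^ k * m → x ∣ m
coprime-∣p^k*m⇒∣m {x} {m = m} x⊥p zero    h = subst (x ∣_) (*-identityˡ m) h
coprime-∣p^k*m⇒∣m {x} {p} {m} x⊥p (suc k) h =
  coprime-∣p^k*m⇒∣m x⊥p k (coprime-divisor x⊥p (subst (x ∣_) (*-assoc p (p ^ k) m) h))

∃prime∣ : ∀ {n} → 2 ≤ n → ∃ λ p → Prime p × p ∣ n
∃prime∣ {n@(suc _)} 2≤n with factorise n
... | record { factors = List.[] ; isFactorisation = n≡1 } = contradiction n≡1 (>⇒≢ 2≤n)
... | record { factors = p List.∷ _ ; isFactorisation = n≡ ; factorsPrime = pp List.∷ _ } =
  p , pp , subst (p ∣_) (sym n≡) (m∣m*n _)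

extractPrimePower : ∀ {p n} → Prime p → .{{NonZero n}} → p ∣ n →
  ∃₂ λ a m → n ≡ p ^ suc a * m × ¬ p ∣ m
extractPrimePower {p} {n} pp = go (<-wellFounded n)
  where
  instance
    p-nonTrivial : NonTrivial p
    p-nonTrivial = prime⇒nonTrivial pp
  go : ∀ {n} → Acc _<_ n → .{{NonZero n}} → p ∣ n → ∃₂ λ a m → n ≡ p ^ suc a * m × ¬ p ∣ m
  go (acc rec) p∣n@(divides k refl) with p ∣? k
  ... | no p∤k = 0 , k , trans (*-comm k p) (cong (_* k) (sym (*-identityʳ p))) , p∤k
  ... | yes p∣k =
    let a , m , k≡ , p∤m = go (rec (quotient-< p∣n)) {{quotient≢0 p∣n}} p∣k
    in suc a , m , trans (cong (_* p) k≡) (trans (*-comm _ p) (sym (*-assoc p (p ^ suc a) m))) ,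
       p∤m

∤⇒≢0 : ∀ {p m} → ¬ p ∣ m → m ≢ 0
∤⇒≢0 {p} p∤m refl = p∤m (p ∣0)

unit⊎∃prime∣ : ∀ {m} → m ≢ 0 → m ≡ 1 ⊎ ∃ λ q → Prime q × q ∣ m
unit⊎∃prime∣ {zero}        m≢0 = contradiction refl m≢0
unit⊎∃prime∣ {1}           _   = inj₁ refl
unit⊎∃prime∣ {suc (suc m)} _   = inj₂ (∃prime∣ (s≤s (s≤s z≤n)))

-- Exponent vectors

infix 4 _≤*_ _≤*?_

_≤*_ : ∀ {k} → Rel (Vec ℕ k) 0ℓ
_≤*_ = Pointwise _≤_

_≤*?_ : ∀ {k} → Decidable (_≤*_ {k})
_≤*?_ = Pointwise.decidable _≤?_

allBelow? : ∀ {k} (bs : Vec ℕ k) {P : Vec ℕ k → Set} →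
  (∀ es → Dec (P es)) → Dec (∀ {es} → es ≤* bs → P es)
allBelow? [] P? = map′ (λ { P[] [] → P[] }) (λ ∀P → ∀P []) (P? [])
allBelow? (b ∷ bs) {P} P? =
  map′ to from (allUpTo? (λ e → allBelow? bs (λ es → P? (e ∷ es))) (suc b))
  where
  to : (∀ {e} → e < suc b → ∀ {es} → es ≤* bs → P (e ∷ es)) → ∀ {es} → es ≤* b ∷ bs → P es
  to ∀P (e≤b ∷ es≤bs) = ∀P (s≤s e≤b) es≤bs
  from : (∀ {es} → es ≤* b ∷ bs → P es) → ∀ {e} → e < suc b → ∀ {es} → es ≤* bs → P (e ∷ es)
  from ∀P (s≤s e≤b) es≤bs = ∀P (e≤b ∷ es≤bs)

-- The exponent-vector form of ¬ DivisorClaw (∏ pᵢ ^ bᵢ).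
NoClawBelow : ∀ {k} → Vec ℕ k → Set
NoClawBelow {k} bs =
  ∀ {c} → c ≤* bs → ∀ {a} → a ≤* bs → ∀ {b} → b ≤* bs → ∀ {d} → d ≤* bs →
  c ≢ replicate k 0 → c ≢ bs → ¬ Claw _≤*_ c a b d

noClawBelow? : ∀ {k} (bs : Vec ℕ k) → Dec (NoClawBelow bs)
noClawBelow? {k} bs =
  allBelow? bs λ c → allBelow? bs λ a → allBelow? bs λ b → allBelow? bs λ d →
    ¬? (c ≟* replicate k 0) →-dec ¬? (c ≟* bs) →-dec ¬? (claw? _≤*?_ c a b d)
  where
  _≟*_ : DecidableEquality (Vec ℕ k)
  _≟*_ = ≡-dec _≟_

comparable-sameTail : ∀ {k} x y {es : Vec ℕ k} → Comparable _≤*_ (x ∷ es) (y ∷ es)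
comparable-sameTail x y =
  Sum.map (_∷ Pointwise.refl ≤-refl) (_∷ Pointwise.refl ≤-refl) (≤-total x y)

noClawBelow-[t] : ∀ t → NoClawBelow (t ∷ [])
noClawBelow-[t] t _ {a₁ ∷ []} _ {b₁ ∷ []} _ _ _ _ claw =
  Claw.a≁b claw (comparable-sameTail a₁ b₁)

≤1-pigeonhole : ∀ {i j k} → i ≤ 1 → j ≤ 1 → k ≤ 1 → i ≡ j ⊎ i ≡ k ⊎ j ≡ k
≤1-pigeonhole z≤n       z≤n       _         = inj₁ refl
≤1-pigeonhole (s≤s z≤n) (s≤s z≤n) _         = inj₁ refl
≤1-pigeonhole z≤n       (s≤s z≤n) z≤n       = inj₂ (inj₁ refl)
≤1-pigeonhole z≤n       (s≤s z≤n) (s≤s z≤n) = inj₂ (inj₂ refl)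
≤1-pigeonhole (s≤s z≤n) z≤n       z≤n       = inj₂ (inj₂ refl)
≤1-pigeonhole (s≤s z≤n) z≤n       (s≤s z≤n) = inj₂ (inj₁ refl)

noClawBelow-[t,1] : ∀ t → NoClawBelow (t ∷ 1 ∷ [])
noClawBelow-[t,1] t _ {a₁ ∷ a₂ ∷ []} (_ ∷ a₂≤1 ∷ []) {b₁ ∷ b₂ ∷ []} (_ ∷ b₂≤1 ∷ [])
                      {d₁ ∷ d₂ ∷ []} (_ ∷ d₂≤1 ∷ []) _ _ claw
  with ≤1-pigeonhole a₂≤1 b₂≤1 d₂≤1
... | inj₁ refl        = Claw.a≁b claw (comparable-sameTail a₁ b₁)
... | inj₂ (inj₁ refl) = Claw.a≁d claw (comparable-sameTail a₁ d₁)
... | inj₂ (inj₂ refl) = Claw.b≁d claw (comparable-sameTail b₁ d₁)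

noClawBelow-[1,1,1] : NoClawBelow (1 ∷ 1 ∷ 1 ∷ [])
noClawBelow-[1,1,1] = from-yes (noClawBelow? (1 ∷ 1 ∷ 1 ∷ []))

noClawBelow-[2,2] : NoClawBelow (2 ∷ 2 ∷ [])
noClawBelow-[2,2] = from-yes (noClawBelow? (2 ∷ 2 ∷ []))

monomial : ∀ {k} → Vec ℕ k → Vec ℕ k → ℕ
monomial []       []       = 1
monomial (p ∷ ps) (e ∷ es) = p ^ e * monomial ps es

DistinctPrimes : ∀ {k} → Vec ℕ k → Set
DistinctPrimes ps = All Prime ps × AllPairs _≢_ ps

monomial-replicate-0 : ∀ {k} (ps : Vec ℕ k) → monomial ps (replicate k 0) ≡ 1
monomial-replicate-0 []       = refl
monomial-replicate-0 (p ∷ ps) = trans (*-identityˡ (monomial ps _)) (monomial-replicate-0 ps)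

prime∤monomial : ∀ {k p} {ps es : Vec ℕ k} → Prime p → All Prime ps → All (p ≢_) ps →
  ¬ p ∣ monomial ps es
prime∤monomial {ps = []}    {[]}    pp []         []           = prime∤1 pp
prime∤monomial {ps = _ ∷ _} {e ∷ _} pp (pq ∷ pqs) (p≢q ∷ p≢qs) =
  prime∤* pp (prime∤^ pp (prime∤prime pp pq p≢q) e) (prime∤monomial pp pqs p≢qs)

∣monomial⇒ : ∀ {k d} {ps bs : Vec ℕ k} → All Prime ps → d ∣ monomial ps bs →
  ∃ λ es → es ≤* bs × d ≡ monomial ps es
∣monomial⇒ {ps = []}    {[]}    []         d∣1 = [] , [] , ∣1⇒≡1 d∣1
∣monomial⇒ {ps = p ∷ _} {b ∷ _} (pp ∷ pps) d∣  =
  let i , d′ , i≤b , d′∣ , d≡ = ∣p^a*m⇒ pp b d∣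
      es , es≤ , d′≡ = ∣monomial⇒ pps d′∣
  in i ∷ es , i≤b ∷ es≤ , trans d≡ (cong (p ^ i *_) d′≡)

monomial-mono : ∀ {k} (ps : Vec ℕ k) {es es′} → es ≤* es′ → monomial ps es ∣ monomial ps es′
monomial-mono []       []              = ∣-refl
monomial-mono (p ∷ ps) (e≤e′ ∷ es≤es′) = *-pres-∣ (^-monoʳ-∣ p e≤e′) (monomial-mono ps es≤es′)

monomial-reflects : ∀ {k} {ps : Vec ℕ k} → DistinctPrimes ps → ∀ {es es′} →
  monomial ps es ∣ monomial ps es′ → es ≤* es′
monomial-reflects {ps = []} _ {[]} {[]} _ = []
monomial-reflects {ps = p ∷ ps} (pp ∷ pps , p≢ps ∷ distinct) {e ∷ es} {e′ ∷ es′} h =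
  p^i∣p^k*m⇒i≤k pp p∤rest e e′ (m*n∣⇒m∣ _ _ h) ∷
  monomial-reflects (pps , distinct)
    (coprime-∣p^k*m⇒∣m (prime∤⇒coprime pp p∤rest) e′ (m*n∣⇒n∣ (p ^ e) _ h))
  where
  p∤rest : ∀ {es} → ¬ p ∣ monomial ps es
  p∤rest = prime∤monomial pp pps p≢ps

noDivisorClaw : ∀ {k} {ps bs : Vec ℕ k} → DistinctPrimes ps → NoClawBelow bs →
  ¬ DivisorClaw (monomial ps bs)
noDivisorClaw {ps = ps} distinct@(pps , _) noClaw
  record { c∣n = c∣n ; a∣n = a∣n ; b∣n = b∣n ; d∣n = d∣n ; c≢1 = c≢1 ; c≢n = c≢n ; claw = claw }
  with ∣monomial⇒ pps c∣n | ∣monomial⇒ pps a∣n | ∣monomial⇒ pps b∣n | ∣monomial⇒ pps d∣n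
... | _ , c≤ , refl | _ , a≤ , refl | _ , b≤ , refl | _ , d≤ , refl =
  noClaw c≤ a≤ b≤ d≤ (λ { refl → c≢1 (monomial-replicate-0 ps) }) (λ { refl → c≢n refl })
    (claw-reflect (monomial ps) (monomial-mono ps) (monomial-reflects distinct) claw)

-- The power graph of ℤ_n

module PowerGraph (n : ℕ) .{{_ : NonZero n}} where

  -- ⟨u⟩ = ⟨gcd(u, n)⟩ in ℤ_n.
  gen : Fin n → ℕ
  gen u = gcd (toℕ u) n

  gen∣n : ∀ u → gen u ∣ n
  gen∣n u = gcd[m,n]∣n (toℕ u) n

  gcd-bezout-mod : ∀ u → ∃ λ x → (x * u) % n ≡ gcd u n % n
  gcd-bezout-mod u with Bézout.identity (gcd-GCD u n)
  ... | Bézout.+- x y eq = x , (begin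
    (x * u) % n            ≡⟨ cong (_% n) eq ⟨
    (gcd u n + y * n) % n  ≡⟨ [m+kn]%n≡m%n (gcd u n) y n ⟩
    gcd u n % n            ∎)
    where open ≡-Reasoning
  -- x * (n - 1) ≡ -x (mod n)
  ... | Bézout.-+ x y eq = x * pred n , (begin
    (x * pred n * u) % n                      ≡⟨ [m+kn]%n≡m%n (x * pred n * u) y n ⟨
    (x * pred n * u + y * n) % n              ≡⟨ cong (λ t → (x * pred n * u + t) % n) eq ⟨
    (x * pred n * u + (gcd u n + x * u)) % n  ≡⟨ cong (_% n) (rearrange x (pred n) u _) ⟩
    (gcd u n + x * u * suc (pred n)) % n      ≡⟨ cong (λ t → (gcd u n + x * u * t) % n) (suc-pred n) ⟩
    (gcd u n + x * u * n) % n                 ≡⟨ [m+kn]%n≡m%n (gcd u n) (x * u) n ⟩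
    gcd u n % n                               ∎)
    where
    open ≡-Reasoning
    rearrange : ∀ x n′ u g → x * n′ * u + (g + x * u) ≡ g + x * u * suc n′
    rearrange = solve-∀

  gcd∣⇒multiple : ∀ u {v} → gcd u n ∣ v → v < n → ∃ λ m → 1 ≤ m × (m * u) % n ≡ v
  gcd∣⇒multiple u (divides k refl) v<n =
    let x , xu≡g = gcd-bezout-mod u
    -- the summand n only makes the exponent positive
    in n + k * x , ≤-trans (>-nonZero⁻¹ n) (m≤m+n n (k * x)) , (begin
    ((n + k * x) * u) % n          ≡⟨ cong (_% n) (rearrange n k x u) ⟩
    (k * (x * u) + u * n) % n      ≡⟨ [m+kn]%n≡m%n (k * (x * u)) u n ⟩
    (k * (x * u)) % n              ≡⟨ %-distribˡ-* k (x * u) n ⟩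
    ((k % n) * ((x * u) % n)) % n  ≡⟨ cong (λ t → (k % n * t) % n) xu≡g ⟩
    ((k % n) * (gcd u n % n)) % n  ≡⟨ %-distribˡ-* k (gcd u n) n ⟨
    (k * gcd u n) % n              ≡⟨ m<n⇒m%n≡m v<n ⟩
    k * gcd u n                    ∎)
    where
    open ≡-Reasoning
    rearrange : ∀ n k x u → (n + k * x) * u ≡ k * (x * u) + u * n
    rearrange = solve-∀

  isPowerOf⇒gen∣ : ∀ {u v} → IsPowerOf n v u → gen u ∣ gen v
  isPowerOf⇒gen∣ {u} (m , _ , um≡v) = gcd-greatest
    (subst (gen u ∣_) um≡v (%-presˡ-∣ (∣n⇒∣m*n m (gcd[m,n]∣m (toℕ u) n)) (gen∣n u)))
    (gen∣n u)

  gen∣⇒isPowerOf : ∀ {u v} → gen u ∣ gen v → IsPowerOf n v u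
  gen∣⇒isPowerOf {u} {v} gu∣gv =
    gcd∣⇒multiple (toℕ u) (∣-trans gu∣gv (gcd[m,n]∣m (toℕ v) n)) (toℕ<n v)

  adj⇒comparable : ∀ {u v} → Adj n u v → Comparable _∣_ (gen u) (gen v)
  adj⇒comparable = Sum.map isPowerOf⇒gen∣ isPowerOf⇒gen∣ ∘ proj₂

  comparable⇒adj : ∀ {u v} → u ≢ v → Comparable _∣_ (gen u) (gen v) → Adj n u v
  comparable⇒adj u≢v gu~gv = u≢v , Sum.map gen∣⇒isPowerOf gen∣⇒isPowerOf gu~gv

  comparableWithAll⇒dominating : ∀ {u} → (∀ w → Comparable _∣_ (gen u) (gen w)) → Dominating n u
  comparableWithAll⇒dominating u~all w w≢u = comparable⇒adj (w≢u ∘ sym) (u~all w)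

  ¬dominating⇒gen≢1 : ∀ {u} → ¬ Dominating n u → gen u ≢ 1
  ¬dominating⇒gen≢1 ¬dom gu≡1 = ¬dom (comparableWithAll⇒dominating λ w →
    inj₁ (subst (_∣ gen w) (sym gu≡1) (1∣ gen w)))

  ¬dominating⇒gen≢n : ∀ {u} → ¬ Dominating n u → gen u ≢ n
  ¬dominating⇒gen≢n ¬dom gu≡n = ¬dom (comparableWithAll⇒dominating λ w →
    inj₂ (subst (gen w ∣_) (sym gu≡n) (gen∣n w)))

  star⇒divisorClaw : HasInducedStar13 n → DivisorClaw n
  star⇒divisorClaw (c , a , b , d , (¬dom-c , _) , (_ , _ , _ , a≢b , a≢d , b≢d) ,
                    (c-a , c-b , c-d) , (a≁b , a≁d , b≁d)) = record
    { c∣n = gen∣n c ; a∣n = gen∣n a ; b∣n = gen∣n b ; d∣n = gen∣n d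
    ; c≢1 = ¬dominating⇒gen≢1 ¬dom-c ; c≢n = ¬dominating⇒gen≢n ¬dom-c
    ; claw = record
      { c~a = adj⇒comparable c-a ; c~b = adj⇒comparable c-b ; c~d = adj⇒comparable c-d
      ; a≁b = a≁b ∘ comparable⇒adj a≢b
      ; a≁d = a≁d ∘ comparable⇒adj a≢d
      ; b≁d = b≁d ∘ comparable⇒adj b≢d } }

  divisor⇒vertex : ∀ {x} → x ∣ n → x < n → Σ (Fin n) λ u → gen u ≡ x
  divisor⇒vertex {x} x∣n x<n = fromℕ< x<n , (begin
    gcd (toℕ (fromℕ< x<n)) n  ≡⟨ cong (λ t → gcd t n) (toℕ-fromℕ< x<n) ⟩
    gcd x n                   ≡⟨ ∣-antisym (gcd[m,n]∣m x n) (gcd-greatest ∣-refl x∣n) ⟩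
    x                         ∎)
    where open ≡-Reasoning

  incomparable⇒<n : ∀ {x y} → x ∣ n → y ∣ n → ¬ Comparable _∣_ x y → x < n
  incomparable⇒<n x∣n y∣n x≁y = ≤∧≢⇒< (∣⇒≤ x∣n) λ { refl → x≁y (inj₂ y∣n) }

  clawOfDivisors⇒star : ∀ {c a b d e} → c ∣ n → a ∣ n → b ∣ n → d ∣ n → e ∣ n →
    Claw _∣_ c a b d → ¬ Comparable _∣_ c e → HasInducedStar13 n
  clawOfDivisors⇒star c∣n a∣n b∣n d∣n e∣n claw c≁e
    with divisor⇒vertex c∣n (incomparable⇒<n c∣n e∣n c≁e)
       | divisor⇒vertex a∣n (incomparable⇒<n a∣n b∣n (Claw.a≁b claw))
       | divisor⇒vertex b∣n (incomparable⇒<n b∣n a∣n (Claw.a≁b claw ∘ swap))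
       | divisor⇒vertex d∣n (incomparable⇒<n d∣n a∣n (Claw.a≁d claw ∘ swap))
       | divisor⇒vertex e∣n (incomparable⇒<n e∣n c∣n (c≁e ∘ swap))
  ... | c , refl | a , refl | b , refl | d , refl | e , refl =
    c , a , b , d ,
    (¬dominating e c≁e , ¬dominating b a≁b , ¬dominating a (a≁b ∘ swap) ,
     ¬dominating a (a≁d ∘ swap)) ,
    (distinct c≢a , distinct c≢b , distinct c≢d ,
     incomparable⇒distinct a≁b , incomparable⇒distinct a≁d , incomparable⇒distinct b≁d) ,
    (comparable⇒adj (distinct c≢a) c~a , comparable⇒adj (distinct c≢b) c~b ,
     comparable⇒adj (distinct c≢d) c~d) ,
    (a≁b ∘ adj⇒comparable , a≁d ∘ adj⇒comparable , b≁d ∘ adj⇒comparable)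
    where
    open Claw claw
    distinct : ∀ {u v} → gen u ≢ gen v → u ≢ v
    distinct gu≢gv = gu≢gv ∘ cong gen
    incomparable⇒distinct : ∀ {u v} → ¬ Comparable _∣_ (gen u) (gen v) → u ≢ v
    incomparable⇒distinct u≁v = distinct (incomparable⇒≢ {_≼_ = _∣_} ∣-refl u≁v)
    ¬dominating : ∀ {u} w → ¬ Comparable _∣_ (gen u) (gen w) → ¬ Dominating n u
    ¬dominating w u≁w dom = u≁w (adj⇒comparable (dom w (incomparable⇒distinct (u≁w ∘ swap))))

-- Orders without a claw

pattern primePowerOrder w = inj₁ w
pattern pqrOrder w        = inj₂ (inj₁ w)
pattern p²q²Order w       = inj₂ (inj₂ (inj₁ w))
pattern p^tqOrder w       = inj₂ (inj₂ (inj₂ w))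

monomial-pqr : ∀ p q r → p ^ 1 * (q ^ 1 * (r ^ 1 * 1)) ≡ p * q * r
monomial-pqr = unfolded
  where
  unfolded : ∀ p q r → p * 1 * (q * 1 * (r * 1 * 1)) ≡ p * q * r
  unfolded = solve-∀

allowed⇒noDivisorClaw : ∀ {n} → AllowedOrder n → ¬ DivisorClaw n
allowed⇒noDivisorClaw (primePowerOrder (p , t , pp , _ , refl)) =
  subst (¬_ ∘ DivisorClaw) (*-identityʳ (p ^ t))
    (noDivisorClaw (pp ∷ [] , [] ∷ []) (noClawBelow-[t] t))
allowed⇒noDivisorClaw (pqrOrder (p , q , r , pp , pq , pr , p≢q , p≢r , q≢r , refl)) =
  subst (¬_ ∘ DivisorClaw) (monomial-pqr p q r)
    (noDivisorClaw (pp ∷ pq ∷ pr ∷ [] , (p≢q ∷ p≢r ∷ []) ∷ (q≢r ∷ []) ∷ [] ∷ [])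
      noClawBelow-[1,1,1])
allowed⇒noDivisorClaw (p²q²Order (p , q , pp , pq , p≢q , refl)) =
  subst (¬_ ∘ DivisorClaw) (cong (p ^ 2 *_) (*-identityʳ (q ^ 2)))
    (noDivisorClaw (pp ∷ pq ∷ [] , (p≢q ∷ []) ∷ [] ∷ []) noClawBelow-[2,2])
allowed⇒noDivisorClaw (p^tqOrder (p , q , t , pp , pq , p≢q , _ , refl)) =
  subst (¬_ ∘ DivisorClaw) (cong (p ^ t *_) (trans (*-identityʳ (q ^ 1)) (*-identityʳ q)))
    (noDivisorClaw (pp ∷ pq ∷ [] , (p≢q ∷ []) ∷ [] ∷ []) (noClawBelow-[t,1] t))

-- Orders with a claw

scaledAntichain⇒star : ∀ {n} .{{_ : NonZero n}} p .{{_ : NonZero p}} {e x y z} →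
  e ∣ n → ¬ Comparable _∣_ p e → p * x ∣ n → p * y ∣ n → p * z ∣ n →
  ¬ Comparable _∣_ x y → ¬ Comparable _∣_ x z → ¬ Comparable _∣_ y z → HasInducedStar13 n
scaledAntichain⇒star {n} p {x = x} {y} {z} e∣n p≁e px∣n py∣n pz∣n x≁y x≁z y≁z =
  PowerGraph.clawOfDivisors⇒star n (∣-trans (m∣m*n x) px∣n) px∣n py∣n pz∣n e∣n claw p≁e
  where
  claw : Claw _∣_ p (p * x) (p * y) (p * z)
  claw = record
    { c~a = inj₁ (m∣m*n x) ; c~b = inj₁ (m∣m*n y) ; c~d = inj₁ (m∣m*n z)
    ; a≁b = *-incomparable p x≁y ; a≁d = *-incomparable p x≁z ; b≁d = *-incomparable p y≁z }

star-s*pqr : ∀ {n} .{{_ : NonZero n}} {s p q r} → Prime s → Prime p → Prime q → Prime r →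
  p ≢ q → p ≢ r → q ≢ r → s * (p * q * r) ∣ n → HasInducedStar13 n
star-s*pqr {n} {s} {p} {q} {r} ps pp pq pr p≢q p≢r q≢r h =
  let e , e∣n , s≁e = witness in
  scaledAntichain⇒star s {{prime⇒nonZero ps}} e∣n s≁e
    (∣-trans (*-monoʳ-∣ s (∣m⇒∣m*n r (m∣m*n q))) h)
    (∣-trans (*-monoʳ-∣ s (n∣m*n*o p r)) h)
    (∣-trans (*-monoʳ-∣ s (n∣m*n (p * q))) h)
    (primes-incomparable pp pq p≢q) (primes-incomparable pp pr p≢r) (primes-incomparable pq pr q≢r)
  where
  -- makes the centre s non-dominating
  witness : ∃ λ e → e ∣ n × ¬ Comparable _∣_ s e
  witness with s ≟ p
  ... | no s≢p   = p , ∣-trans (∣m⇒∣m*n r (m∣m*n q)) (∣-trans (n∣m*n s) h) ,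
                   primes-incomparable ps pp s≢p
  ... | yes refl = q , ∣-trans (n∣m*n*o p r) (∣-trans (n∣m*n s) h) ,
                   primes-incomparable pp pq p≢q

p³q²-divisors : ∀ p q → q ∣ p ^ 3 * q ^ 2 × p * (p * p) ∣ p ^ 3 * q ^ 2 ×
                         p * (p * q) ∣ p ^ 3 * q ^ 2 × p * (q * q) ∣ p ^ 3 * q ^ 2
p³q²-divisors p q =
  divides (p * p * p * q) (e₁ p q) , divides (q * q) (e₂ p q) ,
  divides (p * q) (e₃ p q) , divides (p * p) (e₄ p q)
  where
  e₁ : ∀ p q → p * (p * (p * 1)) * (q * (q * 1)) ≡ p * p * p * q * q
  e₁ = solve-∀
  e₂ : ∀ p q → p * (p * (p * 1)) * (q * (q * 1)) ≡ q * q * (p * (p * p))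
  e₂ = solve-∀
  e₃ : ∀ p q → p * (p * (p * 1)) * (q * (q * 1)) ≡ p * q * (p * (p * q))
  e₃ = solve-∀
  e₄ : ∀ p q → p * (p * (p * 1)) * (q * (q * 1)) ≡ p * p * (p * (q * q))
  e₄ = solve-∀

star-p³q² : ∀ {n} .{{_ : NonZero n}} {p q} → Prime p → Prime q → p ≢ q → p ^ 3 * q ^ 2 ∣ n →
  HasInducedStar13 n
star-p³q² {p = p} {q} pp pq p≢q h with p³q²-divisors p q
... | q∣ , p³∣ , p²q∣ , pq²∣ =
  scaledAntichain⇒star p (∣-trans q∣ h) p≁q (∣-trans p³∣ h) (∣-trans p²q∣ h) (∣-trans pq²∣ h)
    (*-incomparable p p≁q) p²≁q²
    (subst (λ x → ¬ Comparable _∣_ x (q * q)) (*-comm q p) (*-incomparable q p≁q))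
  where
  instance
    p≢0 : NonZero p
    p≢0 = prime⇒nonZero pp
    q≢0 : NonZero q
    q≢0 = prime⇒nonZero pq
  p∤q : ¬ p ∣ q
  p∤q = prime∤prime pp pq p≢q
  q∤p : ¬ q ∣ p
  q∤p = prime∤prime pq pp (p≢q ∘ sym)
  p≁q : ¬ Comparable _∣_ p q
  p≁q = primes-incomparable pp pq p≢q
  p²≁q² : ¬ Comparable _∣_ (p * p) (q * q)
  p²≁q² = [ prime∤* pp p∤q p∤q ∘ m*n∣⇒m∣ p p , prime∤* pq q∤p q∤p ∘ m*n∣⇒m∣ q q ]′

classify-p^a*q^b : ∀ {n} .{{_ : NonZero n}} {p q} → Prime p → Prime q → p ≢ q → ∀ a b →
  n ≡ p ^ suc a * q ^ suc b → AllowedOrder n ⊎ HasInducedStar13 n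
classify-p^a*q^b {p = p} {q} pp pq p≢q zero b n≡ =
  inj₁ (p^tqOrder (q , p , suc b , pq , pp , p≢q ∘ sym , s≤s z≤n ,
    trans n≡ (trans (*-comm (p ^ 1) _) (cong (q ^ suc b *_) (*-identityʳ p)))))
classify-p^a*q^b {p = p} {q} pp pq p≢q (suc a) zero n≡ =
  inj₁ (p^tqOrder (p , q , suc (suc a) , pp , pq , p≢q , s≤s z≤n ,
    trans n≡ (cong (p ^ suc (suc a) *_) (*-identityʳ q))))
classify-p^a*q^b pp pq p≢q 1 1 n≡ = inj₁ (p²q²Order (_ , _ , pp , pq , p≢q , n≡))
classify-p^a*q^b {p = p} {q} pp pq p≢q (suc (suc a)) (suc b) n≡ =
  inj₂ (star-p³q² pp pq p≢q (subst (p ^ 3 * q ^ 2 ∣_) (sym n≡)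
    (*-pres-∣ (^-monoʳ-∣ p {3} {3 + a} (s≤s (s≤s (s≤s z≤n))))
              (^-monoʳ-∣ q {2} {2 + b} (s≤s (s≤s z≤n))))))
classify-p^a*q^b {p = p} {q} pp pq p≢q 1 (suc (suc b)) n≡ =
  inj₂ (star-p³q² pq pp (p≢q ∘ sym) (subst (q ^ 3 * p ^ 2 ∣_) (sym (trans n≡ (*-comm (p ^ 2) _)))
    (*-pres-∣ (^-monoʳ-∣ q {3} {3 + b} (s≤s (s≤s (s≤s z≤n)))) (^-monoʳ-∣ p {2} {2} ≤-refl))))

classify-pqr∣ : ∀ {n} .{{_ : NonZero n}} {p q r} → Prime p → Prime q → Prime r →
  p ≢ q → p ≢ r → q ≢ r → p * q * r ∣ n → AllowedOrder n ⊎ HasInducedStar13 n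
classify-pqr∣ {n} {p} {q} {r} pp pq pr p≢q p≢r q≢r (divides l n≡)
  with unit⊎∃prime∣ {l} (λ { refl → ≢-nonZero⁻¹ n n≡ })
... | inj₁ refl =
  inj₁ (pqrOrder (p , q , r , pp , pq , pr , p≢q , p≢r , q≢r , trans n≡ (*-identityˡ _)))
... | inj₂ (s , ps , s∣l) =
  inj₂ (star-s*pqr ps pp pq pr p≢q p≢r q≢r (subst (_ ∣_) (sym n≡) (*-monoˡ-∣ (p * q * r) s∣l)))

classify-p^a*q^b*k : ∀ {n} .{{_ : NonZero n}} {p q k} → Prime p → Prime q → p ≢ q → ∀ a b →
  n ≡ p ^ suc a * (q ^ suc b * k) → ¬ p ∣ k → ¬ q ∣ k → AllowedOrder n ⊎ HasInducedStar13 n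
classify-p^a*q^b*k {p = p} {q} {k} pp pq p≢q a b n≡ p∤k q∤k with unit⊎∃prime∣ (∤⇒≢0 q∤k)
... | inj₁ refl =
  classify-p^a*q^b pp pq p≢q a b (trans n≡ (cong (p ^ suc a *_) (*-identityʳ _)))
... | inj₂ (r , pr , r∣k) =
  classify-pqr∣ pp pq pr p≢q (λ { refl → p∤k r∣k }) (λ { refl → q∤k r∣k }) (subst (_ ∣_) (sym n≡)
    (subst (_∣ p ^ suc a * (q ^ suc b * k)) (sym (*-assoc p q r))
      (*-pres-∣ (m∣m*n {p} (p ^ a)) (*-pres-∣ (m∣m*n {q} (q ^ b)) r∣k))))

classify : ∀ n .{{_ : NonZero n}} → 2 ≤ n → AllowedOrder n ⊎ HasInducedStar13 n
classify n 2≤n with ∃prime∣ 2≤n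
... | p , pp , p∣n with extractPrimePower pp p∣n
... | a , m , n≡ , p∤m with unit⊎∃prime∣ (∤⇒≢0 p∤m)
... | inj₁ refl = inj₁ (primePowerOrder (p , suc a , pp , s≤s z≤n , trans n≡ (*-identityʳ _)))
... | inj₂ (q , pq , q∣m) with extractPrimePower pq {{≢-nonZero (∤⇒≢0 p∤m)}} q∣m
... | b , k , refl , q∤k =
  classify-p^a*q^b*k pp pq (λ { refl → p∤m q∣m }) a b n≡ (p∤m ∘ ∣n⇒∣m*n (q ^ suc b)) q∤k

mainTheorem11 : (n : ℕ) → .{{_ : NonZero n}} → 2 ≤ n →
    (¬ HasInducedStar13 n) ⇔ AllowedOrder n
mainTheorem11 n 2≤n = mk⇔
  (λ noStar → [ id , ⊥-elim ∘ noStar ]′ (classify n 2≤n))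
  (λ allowed → allowed⇒noDivisorClaw allowed ∘ PowerGraph.star⇒divisorClaw n)
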